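{- Let $G$ be a finite, simple, connected graph which is not $P_2$ (the path with two vertices and one edge), not $Q$, and not $L(Q)$, where $Q$ is the graph obtained from a triangle by attaching one pendant edge to one of its vertices, and $L(Q)$ is its line graph ($K_4$ minus an edge). Let $m > 0$, $\phi \in \operatorname{Aut} L^{2m}(G)$ and $\phi' \in \operatorname{Aut} G$ be such that $\gamma_{G,2m}(\phi') = \phi$. Then $\phi(\langle v\rangle_m) = \langle \phi'(v)\rangle_m$ for all $v \in V(G)$.
   Context: For a simple graph $G$, the line graph $L(G)$ has vertex set $E(G)$, two edges being adjacent if they share an endpoint; $L^k(G) = L(L^{k-1}(G))$. The map $\gamma_G:\operatorname{Aut} G \to \operatorname{Aut} L(G)$ is defined by $(\gamma_G\phi)(\{u,v\}) = \{\phi(u),\phi(v)\}$, and $\gamma_{G,k} = \gamma_{L^{k-1}(G)} \circ \dotsm \circ \gamma_{L(G)} \circ \gamma_G$. For any simple graph $H$, every vertex of $L^2(H)$ is a pair $\{\{u,v\},\{v,w\}\}$ of distinct edges of $H$ sharing the vertex $v$; define $f_H: V(L^2(H)) \to V(H)$ by $f_H(\{\{u,v\},\{v,w\}\}) = v$. For $v \in V(G)$ define $\langle v\rangle_1 = f_G^{ -1}(v) \subseteq V(L^2(G))$ and recursively $\langle v\rangle_{k+1} = \bigcup_{u \in \langle v\rangle_k} f_{L^{2k}(G)}^{ -1}(u) \subseteq V(L^{2k+2}(G))$. -}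

module Defs where

open import Data.Nat using (ℕ; zero; suc; _<ᵇ_)
open import Data.Fin using (Fin; toℕ) renaming (_≟_ to _≟ᶠ_)
open import Data.Bool using (Bool; true; false; not; _∧_; _∨_; if_then_else_; T)
open import Data.List using (List; []; _∷_; length; lookup; concatMap)
open import Data.List.Relation.Unary.Any using (Any; any?; index)
open import Data.List.Base using () renaming (allFin to allFinL)
open import Data.Product using (Σ; ∃; _×_; _,_; proj₁; proj₂)
open import Data.Product.Properties using (≡-dec)
open import Data.Sum using (_⊎_)
open import Relation.Nullary using (¬_; yes; no; ⌊_⌋)
open import Relation.Nullary.Decidable using (_⊎-dec_)
open import Relation.Binary.PropositionalEquality using (_≡_)
open import Function using (id; _∘_)

record Graph : Set where
  constructor mkGraph
  field
    n   : ℕ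
    adj : Fin n → Fin n → Bool
open Graph public

V : Graph → Set
V G = Fin (n G)

IsSimple : Graph → Set
IsSimple G = (∀ i j → adj G i j ≡ adj G j i) × (∀ i → adj G i i ≡ false)

infix 4 _==_
_==_ : ∀ {k} → Fin k → Fin k → Bool
i == j = ⌊ i ≟ᶠ j ⌋

-- Edges {u,v} represented by the ordered pair (u , v) with u < v,
-- listed in lexicographic order.
isEdge : (G : Graph) → V G → V G → Bool
isEdge G i j = (toℕ i <ᵇ toℕ j) ∧ adj G i j

edgeList : (G : Graph) → List (V G × V G)
edgeList G = concatMap (λ i → concatMap (λ j → if isEdge G i j then (i , j) ∷ [] else []) (allFinL (n G))) (allFinL (n G))

ends : (G : Graph) → Fin (length (edgeList G)) → V G × V G
ends G e = lookup (edgeList G) e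

sharesEnd : ∀ {k} → Fin k × Fin k → Fin k × Fin k → Bool
sharesEnd (u₁ , v₁) (u₂ , v₂) = (u₁ == u₂) ∨ (u₁ == v₂) ∨ (v₁ == u₂) ∨ (v₁ == v₂)

L : Graph → Graph
L G = mkGraph (length (edgeList G)) (λ a b → not (a == b) ∧ sharesEnd (ends G a) (ends G b))

Lⁿ : ℕ → Graph → Graph
Lⁿ zero G = G
Lⁿ (suc k) G = L (Lⁿ k G)

-- γ_G : a vertex map ψ of G induces the map {u,v} ↦ {ψ u, ψ v} on edges.
-- (If {ψ u, ψ v} is not an edge -- impossible when ψ ∈ Aut G -- the edge is left fixed.)
γ : (G : Graph) → (V G → V G) → (V (L G) → V (L G))
γ G ψ e with any? (λ p → ≡-dec _≟ᶠ_ _≟ᶠ_ p (ψ (proj₁ (ends G e)) , ψ (proj₂ (ends G e)))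
                    ⊎-dec ≡-dec _≟ᶠ_ _≟ᶠ_ p (ψ (proj₂ (ends G e)) , ψ (proj₁ (ends G e)))) (edgeList G)
... | yes p = index p
... | no _ = e

γₖ : (G : Graph) (k : ℕ) → (V G → V G) → (V (Lⁿ k G) → V (Lⁿ k G))
γₖ G zero ψ = ψ
γₖ G (suc k) ψ = γ (Lⁿ k G) (γₖ G k ψ)

IsIso : (G H : Graph) → (V G → V H) → Set
IsIso G H φ = (Σ (V H → V G) λ ψ → (∀ x → ψ (φ x) ≡ x) × (∀ y → φ (ψ y) ≡ y))
            × (∀ i j → adj H (φ i) (φ j) ≡ adj G i j)

IsAut : (G : Graph) → (V G → V G) → Set
IsAut G φ = IsIso G G φ

_≅_ : Graph → Graph → Set
G ≅ H = Σ (V G → V H) (IsIso G H)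

data Walk (G : Graph) : V G → V G → Set where
  here : ∀ {u} → Walk G u u
  step : ∀ {u w v} → T (adj G u w) → Walk G w v → Walk G u v

Connected : Graph → Set
Connected G = ∀ u v → Walk G u v

P₂ : Graph
P₂ = mkGraph 2 (λ i j → not (i == j))

qAdj : ℕ → ℕ → Bool
qAdj 0 1 = true
qAdj 1 0 = true
qAdj 0 2 = true
qAdj 2 0 = true
qAdj 1 2 = true
qAdj 2 1 = true
qAdj 0 3 = true
qAdj 3 0 = true
qAdj _ _ = false

Q : Graph
Q = mkGraph 4 (λ i j → qAdj (toℕ i) (toℕ j))

common : ∀ {k} → Fin k × Fin k → Fin k × Fin k → Fin k
common (u₁ , v₁) (u₂ , v₂) = if (u₁ == u₂) ∨ (u₁ == v₂) then u₁ else v₁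

f : (H : Graph) → V (L (L H)) → V H
f H x = common (ends H (proj₁ (ends (L H) x))) (ends H (proj₂ (ends (L H) x)))

twice : ℕ → ℕ
twice zero = zero
twice (suc k) = suc (suc (twice k))

-- ⟨ v ⟩ k ⊆ V(L^{2k}(G)) as a predicate; ⟨v⟩₀ = {v}, ⟨v⟩_{k+1} = f_{L^{2k}G}⁻¹(⟨v⟩_k)
⟨_⟩ : {G : Graph} → V G → (k : ℕ) → V (Lⁿ (twice k) G) → Set
⟨_⟩ v zero x = x ≡ v
⟨_⟩ {G} v (suc k) x = ⟨ v ⟩ k (f (Lⁿ (twice k) G) x)

-- A vertex of L²(H) is a pair of distinct edges of H; they meet in exactly one vertex, and
-- f_H picks it. An automorphism ψ of H maps that pair of edges to a pair meeting in ψ of the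
-- common vertex, so f_H ∘ γ_{L(H)}(γ_H ψ) = ψ ∘ f_H. Iterating this naturality m times gives
-- ⟨ψ v⟩_m ∘ γ_{H,2m}(ψ) = ⟨v⟩_m, which is the claim once φ = γ_{G,2m}(φ′).
module Submission where

open import Defs
open import Data.Nat using (ℕ; zero; suc; _<_)
open import Data.Nat.Properties using (<ᵇ⇒<; <⇒<ᵇ; <-irrefl; <-asym; <-cmp)
open import Data.Fin using (Fin; toℕ; zero; suc) renaming (_≟_ to _≟ᶠ_)
open import Data.Fin.Properties using (toℕ-injective)
open import Data.Bool using (true; false; if_then_else_; T)
open import Data.Bool.Properties using (T-∧)
open import Data.Unit using (tt)
open import Data.Empty using (⊥-elim)
open import Data.List using (List; []; _∷_; lookup; concatMap)
open import Data.List.Base using () renaming (allFin to allFinL)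
open import Data.List.Relation.Unary.Any using (Any; here; satisfied; any?)
open import Data.List.Relation.Unary.Any.Properties using (lookup-index)
import Data.List.Relation.Unary.All as All
open import Data.List.Relation.Unary.Unique.Propositional using (Unique; []; _∷_)
import Data.List.Relation.Unary.Unique.Propositional.Properties as Unique
open import Data.List.Membership.Propositional using (_∈_; lose; find)
open import Data.List.Membership.Propositional.Properties
  using (∈-concatMap⁺; ∈-concatMap⁻; ∈-allFin; ∈-lookup)
open import Data.Product using (Σ; ∃; _×_; _,_; proj₁; proj₂; swap; map)
open import Data.Product.Properties using (≡-dec)
open import Data.Sum using (_⊎_; inj₁; inj₂)
open import Function using (_∘_)
open import Function.Bundles using (_⇔_; mk⇔; Equivalence)
open import Function.Definitions using (Injective)
open import Relation.Binary using (tri<; tri≈; tri>)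
open import Relation.Binary.PropositionalEquality using (_≡_; _≢_; refl; sym; trans; cong; cong₂; subst)
open import Relation.Nullary using (¬_; yes; no)
open import Relation.Nullary.Decidable using (_⊎-dec_)

open Equivalence using (to; from)

private
  variable
    A B : Set
    k : ℕ

lookup-injective : {xs : List A} → Unique xs → ∀ {i j} → lookup xs i ≡ lookup xs j → i ≡ j
lookup-injective (_ ∷ _) {zero} {zero} _ = refl
lookup-injective (x∉ ∷ _) {zero} {suc j} e = ⊥-elim (All.lookup x∉ (∈-lookup j) e)
lookup-injective (x∉ ∷ _) {suc i} {zero} e = ⊥-elim (All.lookup x∉ (∈-lookup i) (sym e))
lookup-injective (_ ∷ u) {suc i} {suc j} e = cong suc (lookup-injective u e)

Unique-concatMap : (key : B → A) (g : A → List B) →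
  (∀ a → Unique (g a)) → (∀ {a b} → b ∈ g a → key b ≡ a) →
  ∀ {xs} → Unique xs → Unique (concatMap g xs)
Unique-concatMap key g g-unique g-key [] = []
Unique-concatMap key g g-unique g-key {x ∷ xs} (x∉ ∷ u) =
  Unique.++⁺ (g-unique x) (Unique-concatMap key g g-unique g-key u) disjoint
  where
  disjoint : ∀ {b} → ¬ (b ∈ g x × b ∈ concatMap g xs)
  disjoint (b∈gx , b∈rest) with find (∈-concatMap⁻ g b∈rest)
  ... | a , a∈xs , b∈ga = All.lookup x∉ a∈xs (trans (sym (g-key b∈gx)) (g-key b∈ga))

T-injective : ∀ {x y} → (T x ⇔ T y) → x ≡ y
T-injective {false} {false} _ = refl
T-injective {false} {true} x⇔y = ⊥-elim (from x⇔y tt)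
T-injective {true} {false} x⇔y = ⊥-elim (to x⇔y tt)
T-injective {true} {true} _ = refl

cell : (H : Graph) → V H → V H → List (V H × V H)
cell H i j = if isEdge H i j then (i , j) ∷ [] else []

vertices : (H : Graph) → List (V H)
vertices H = allFinL (n H)

row : (H : Graph) → V H → List (V H × V H)
row H i = concatMap (cell H i) (vertices H)

∈-cell : (H : Graph) {i j : V H} {p : V H × V H} →
  p ∈ cell H i j ⇔ (p ≡ (i , j) × T (isEdge H i j))
∈-cell H {i} {j} with isEdge H i j
... | true = mk⇔ (λ { (here refl) → refl , tt }) (λ { (refl , _) → here refl })
... | false = mk⇔ (λ ()) (λ ())

∈-edgeList : (H : Graph) {i j : V H} → (i , j) ∈ edgeList H ⇔ T (isEdge H i j)
∈-edgeList H {i} {j} = mk⇔ sound complete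
  where
  sound : (i , j) ∈ edgeList H → T (isEdge H i j)
  sound ij∈ with satisfied (∈-concatMap⁻ (row H) {vertices H} ij∈)
  ... | i′ , ij∈row with satisfied (∈-concatMap⁻ (cell H i′) {vertices H} ij∈row)
  ... | j′ , ij∈cell with to (∈-cell H) ij∈cell
  ... | refl , edge = edge
  complete : T (isEdge H i j) → (i , j) ∈ edgeList H
  complete edge =
    ∈-concatMap⁺ (row H) {vertices H} (lose (∈-allFin i)
      (∈-concatMap⁺ (cell H i) {vertices H} (lose (∈-allFin j) (from (∈-cell H) (refl , edge)))))

Unique-edgeList : (H : Graph) → Unique (edgeList H)
Unique-edgeList H =
  Unique-concatMap proj₁ (row H) Unique-row row-key (Unique.allFin⁺ (n H))
  where
  Unique-cell : ∀ i j → Unique (cell H i j)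
  Unique-cell i j with isEdge H i j
  ... | true = All.[] ∷ []
  ... | false = []
  Unique-row : ∀ i → Unique (row H i)
  Unique-row i = Unique-concatMap proj₂ (cell H i) (Unique-cell i)
    (λ p∈ → cong proj₂ (proj₁ (to (∈-cell H) p∈))) (Unique.allFin⁺ (n H))
  row-key : ∀ {i p} → p ∈ row H i → proj₁ p ≡ i
  row-key {i} p∈ with satisfied (∈-concatMap⁻ (cell H i) {vertices H} p∈)
  ... | _ , p∈cell = cong proj₁ (proj₁ (to (∈-cell H) p∈cell))

ends-injective : (H : Graph) → Injective _≡_ _≡_ (ends H)
ends-injective H = lookup-injective (Unique-edgeList H)

isEdge-ends : (H : Graph) (e : V (L H)) → T (isEdge H (proj₁ (ends H e)) (proj₂ (ends H e)))
isEdge-ends H e = to (∈-edgeList H) (∈-lookup e)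

Ordered : Fin k × Fin k → Set
Ordered (u , v) = toℕ u < toℕ v

ends-ordered : (H : Graph) (e : V (L H)) → Ordered (ends H e)
ends-ordered H e = <ᵇ⇒< _ _ (proj₁ (to T-∧ (isEdge-ends H e)))

ends-adj : (H : Graph) (e : V (L H)) → T (adj H (proj₁ (ends H e)) (proj₂ (ends H e)))
ends-adj H e = proj₂ (to T-∧ (isEdge-ends H e))

_∈ₚ_ : Fin k → Fin k × Fin k → Set
w ∈ₚ (u , v) = w ≡ u ⊎ w ≡ v

_≈ₚ_ : Fin k × Fin k → Fin k × Fin k → Set
p ≈ₚ q = p ≡ q ⊎ p ≡ swap q

Meet : Fin k × Fin k → Fin k × Fin k → Set
Meet p q = ∃ λ w → w ∈ₚ p × w ∈ₚ q

≈ₚ-sym : {p q : Fin k × Fin k} → p ≈ₚ q → q ≈ₚ p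
≈ₚ-sym (inj₁ refl) = inj₁ refl
≈ₚ-sym (inj₂ refl) = inj₂ refl

≈ₚ-trans : {p q r : Fin k × Fin k} → p ≈ₚ q → q ≈ₚ r → p ≈ₚ r
≈ₚ-trans (inj₁ refl) q≈r = q≈r
≈ₚ-trans (inj₂ refl) (inj₁ refl) = inj₂ refl
≈ₚ-trans (inj₂ refl) (inj₂ refl) = inj₁ refl

∈ₚ-resp-≈ₚ : {w : Fin k} {p q : Fin k × Fin k} → p ≈ₚ q → w ∈ₚ p → w ∈ₚ q
∈ₚ-resp-≈ₚ (inj₁ refl) w∈p = w∈p
∈ₚ-resp-≈ₚ (inj₂ refl) (inj₁ w≡v) = inj₂ w≡v
∈ₚ-resp-≈ₚ (inj₂ refl) (inj₂ w≡u) = inj₁ w≡u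

pair-≈ₚ : {u v : Fin k} {q : Fin k × Fin k} → u ≢ v → u ∈ₚ q → v ∈ₚ q → (u , v) ≈ₚ q
pair-≈ₚ u≢v (inj₁ refl) (inj₁ refl) = ⊥-elim (u≢v refl)
pair-≈ₚ u≢v (inj₁ refl) (inj₂ refl) = inj₁ refl
pair-≈ₚ u≢v (inj₂ refl) (inj₁ refl) = inj₂ refl
pair-≈ₚ u≢v (inj₂ refl) (inj₂ refl) = ⊥-elim (u≢v refl)

meet-unique : {p q : Fin k × Fin k} {w w′ : Fin k} → ¬ p ≈ₚ q →
  w ∈ₚ p → w ∈ₚ q → w′ ∈ₚ p → w′ ∈ₚ q → w ≡ w′
meet-unique {w = w} {w′} p≉q w∈p w∈q w′∈p w′∈q with w ≟ᶠ w′
... | yes w≡w′ = w≡w′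
... | no w≢w′ =
  ⊥-elim (p≉q (≈ₚ-trans (≈ₚ-sym (pair-≈ₚ w≢w′ w∈p w′∈p)) (pair-≈ₚ w≢w′ w∈q w′∈q)))

≈ₚ-ordered : {p q : Fin k × Fin k} → Ordered p → Ordered q → p ≈ₚ q → p ≡ q
≈ₚ-ordered _ _ (inj₁ p≡q) = p≡q
≈ₚ-ordered p< q< (inj₂ refl) = ⊥-elim (<-asym p< q<)

¬≈ₚ-ends : (H : Graph) {a b : V (L H)} → a ≢ b → ¬ ends H a ≈ₚ ends H b
¬≈ₚ-ends H {a} {b} a≢b =
  a≢b ∘ ends-injective H ∘ ≈ₚ-ordered (ends-ordered H a) (ends-ordered H b)

∈ₚ-map : (ψ : Fin k → Fin k) {w : Fin k} {p : Fin k × Fin k} → w ∈ₚ p → ψ w ∈ₚ map ψ ψ p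
∈ₚ-map ψ (inj₁ refl) = inj₁ refl
∈ₚ-map ψ (inj₂ refl) = inj₂ refl

∈ₚ-map⁻ : (ψ : Fin k → Fin k) {w : Fin k} {p : Fin k × Fin k} →
  w ∈ₚ map ψ ψ p → ∃ λ u → u ∈ₚ p × w ≡ ψ u
∈ₚ-map⁻ ψ (inj₁ refl) = _ , inj₁ refl , refl
∈ₚ-map⁻ ψ (inj₂ refl) = _ , inj₂ refl , refl

≈ₚ-map⁻ : {ψ : Fin k → Fin k} → Injective _≡_ _≡_ ψ →
  {p q : Fin k × Fin k} → map ψ ψ p ≈ₚ map ψ ψ q → p ≈ₚ q
≈ₚ-map⁻ ψ-inj (inj₁ e) = inj₁ (cong₂ _,_ (ψ-inj (cong proj₁ e)) (ψ-inj (cong proj₂ e)))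
≈ₚ-map⁻ ψ-inj (inj₂ e) = inj₂ (cong₂ _,_ (ψ-inj (cong proj₁ e)) (ψ-inj (cong proj₂ e)))

Meet-sym : {p q : Fin k × Fin k} → Meet p q → Meet q p
Meet-sym (w , w∈p , w∈q) = w , w∈q , w∈p

Meet-resp-≈ₚ : {p p′ q q′ : Fin k × Fin k} → p ≈ₚ p′ → q ≈ₚ q′ → Meet p q → Meet p′ q′
Meet-resp-≈ₚ p≈ q≈ (w , w∈p , w∈q) = w , ∈ₚ-resp-≈ₚ p≈ w∈p , ∈ₚ-resp-≈ₚ q≈ w∈q

Meet-map : {ψ : Fin k → Fin k} → Injective _≡_ _≡_ ψ →
  {p q : Fin k × Fin k} → Meet (map ψ ψ p) (map ψ ψ q) ⇔ Meet p q
Meet-map {ψ = ψ} ψ-inj = mk⇔ reflect (λ (w , w∈p , w∈q) → ψ w , ∈ₚ-map ψ w∈p , ∈ₚ-map ψ w∈q)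
  where
  reflect : ∀ {p q} → Meet (map ψ ψ p) (map ψ ψ q) → Meet p q
  reflect (_ , w∈ψp , w∈ψq) with ∈ₚ-map⁻ ψ w∈ψp | ∈ₚ-map⁻ ψ w∈ψq
  ... | u , u∈p , refl | u′ , u′∈q , ψu≡ψu′ = u , u∈p , subst (_∈ₚ _) (sym (ψ-inj ψu≡ψu′)) u′∈q

T-sharesEnd : (p q : Fin k × Fin k) → T (sharesEnd p q) ⇔ Meet p q
T-sharesEnd (u₁ , v₁) (u₂ , v₂) with u₁ ≟ᶠ u₂ | u₁ ≟ᶠ v₂ | v₁ ≟ᶠ u₂ | v₁ ≟ᶠ v₂
... | yes e | _ | _ | _ = mk⇔ (λ _ → u₁ , inj₁ refl , inj₁ e) _
... | no _ | yes e | _ | _ = mk⇔ (λ _ → u₁ , inj₁ refl , inj₂ e) _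
... | no _ | no _ | yes e | _ = mk⇔ (λ _ → v₁ , inj₂ refl , inj₁ e) _
... | no _ | no _ | no _ | yes e = mk⇔ (λ _ → v₁ , inj₂ refl , inj₂ e) _
... | no u₁≢u₂ | no u₁≢v₂ | no v₁≢u₂ | no v₁≢v₂ = mk⇔ (λ ()) disjoint
  where
  disjoint : ¬ Meet (u₁ , v₁) (u₂ , v₂)
  disjoint (_ , inj₁ refl , inj₁ refl) = u₁≢u₂ refl
  disjoint (_ , inj₁ refl , inj₂ refl) = u₁≢v₂ refl
  disjoint (_ , inj₂ refl , inj₁ refl) = v₁≢u₂ refl
  disjoint (_ , inj₂ refl , inj₂ refl) = v₁≢v₂ refl

T-adj-L : (H : Graph) (a b : V (L H)) → T (adj (L H) a b) ⇔ (a ≢ b × Meet (ends H a) (ends H b))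
T-adj-L H a b with a ≟ᶠ b
... | yes refl = mk⇔ (λ ()) (λ (a≢a , _) → ⊥-elim (a≢a refl))
... | no a≢b = mk⇔ (λ m → a≢b , to (T-sharesEnd _ _) m) (from (T-sharesEnd _ _) ∘ proj₂)

common-∈ₚ : {p q : Fin k × Fin k} → Meet p q → common p q ∈ₚ p × common p q ∈ₚ q
common-∈ₚ {p = u₁ , v₁} {u₂ , v₂} (w , w∈p , w∈q) with u₁ ≟ᶠ u₂ | u₁ ≟ᶠ v₂
... | yes e | _ = inj₁ refl , inj₁ e
... | no _ | yes e = inj₁ refl , inj₂ e
... | no u₁≢u₂ | no u₁≢v₂ = inj₂ refl , v₁∈q w∈p w∈q
  where
  v₁∈q : w ∈ₚ (u₁ , v₁) → w ∈ₚ (u₂ , v₂) → v₁ ∈ₚ (u₂ , v₂)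
  v₁∈q (inj₂ refl) w∈q = w∈q
  v₁∈q (inj₁ refl) (inj₁ w≡u₂) = ⊥-elim (u₁≢u₂ w≡u₂)
  v₁∈q (inj₁ refl) (inj₂ w≡v₂) = ⊥-elim (u₁≢v₂ w≡v₂)

common-unique : {p q : Fin k × Fin k} {w : Fin k} → ¬ p ≈ₚ q → w ∈ₚ p → w ∈ₚ q → common p q ≡ w
common-unique p≉q w∈p w∈q =
  let c∈p , c∈q = common-∈ₚ (_ , w∈p , w∈q) in meet-unique p≉q c∈p c∈q w∈p w∈q

Symmetric : Graph → Set
Symmetric H = ∀ i j → adj H i j ≡ adj H j i

record IsInducedEmbedding (H : Graph) (ψ : V H → V H) : Set where
  field
    injective : Injective _≡_ _≡_ ψ
    adj-preserved : ∀ i j → adj H (ψ i) (ψ j) ≡ adj H i j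

open IsInducedEmbedding

Symmetric-L : (H : Graph) → Symmetric (L H)
Symmetric-L H a b = T-injective (mk⇔ (adj-flip a b) (adj-flip b a))
  where
  adj-flip : ∀ a b → T (adj (L H) a b) → T (adj (L H) b a)
  adj-flip a b ab with to (T-adj-L H a b) ab
  ... | a≢b , m = from (T-adj-L H b a) (a≢b ∘ sym , Meet-sym m)

Symmetric-Lⁿ : (G : Graph) → Symmetric G → ∀ k → Symmetric (Lⁿ k G)
Symmetric-Lⁿ G G-sym zero = G-sym
Symmetric-Lⁿ G G-sym (suc k) = Symmetric-L (Lⁿ k G)

module _ (H : Graph) (H-sym : Symmetric H) (ψ : V H → V H) (ψ-emb : IsInducedEmbedding H ψ) where

  γ-ends : ∀ e → ends H (γ H ψ e) ≈ₚ map ψ ψ (ends H e)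
  γ-ends e with any? (λ p → ≡-dec _≟ᶠ_ _≟ᶠ_ p (ψ (proj₁ (ends H e)) , ψ (proj₂ (ends H e)))
                  ⊎-dec ≡-dec _≟ᶠ_ _≟ᶠ_ p (ψ (proj₂ (ends H e)) , ψ (proj₁ (ends H e)))) (edgeList H)
  ... | yes found = lookup-index found
  ... | no not-found = ⊥-elim (not-found image-is-edge)
    where
    u = proj₁ (ends H e)
    v = proj₂ (ends H e)
    ψu~ψv : T (adj H (ψ u) (ψ v))
    ψu~ψv = subst T (sym (adj-preserved ψ-emb u v)) (ends-adj H e)
    edge : ∀ {i j} → toℕ i < toℕ j → T (adj H i j) → (i , j) ∈ edgeList H
    edge i<j i~j = from (∈-edgeList H) (from T-∧ (<⇒<ᵇ i<j , i~j))
    image-is-edge : Any _ (edgeList H)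
    image-is-edge with <-cmp (toℕ (ψ u)) (toℕ (ψ v))
    ... | tri< ψu<ψv _ _ = lose (edge ψu<ψv ψu~ψv) (inj₁ refl)
    ... | tri≈ _ ψu≡ψv _ =
      ⊥-elim (<-irrefl (cong toℕ (injective ψ-emb (toℕ-injective ψu≡ψv))) (ends-ordered H e))
    ... | tri> _ _ ψv<ψu = lose (edge ψv<ψu (subst T (H-sym (ψ u) (ψ v)) ψu~ψv)) (inj₂ refl)

  γ-injective : Injective _≡_ _≡_ (γ H ψ)
  γ-injective {a} {b} γa≡γb =
    ends-injective H (≈ₚ-ordered (ends-ordered H a) (ends-ordered H b) (≈ₚ-map⁻ (injective ψ-emb) ψa≈ψb))
    where
    ψa≈ψb : map ψ ψ (ends H a) ≈ₚ map ψ ψ (ends H b)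
    ψa≈ψb = ≈ₚ-trans (≈ₚ-sym (γ-ends a)) (subst (_≈ₚ _) (cong (ends H) (sym γa≡γb)) (γ-ends b))

  γ-adj-preserved : ∀ a b → adj (L H) (γ H ψ a) (γ H ψ b) ≡ adj (L H) a b
  γ-adj-preserved a b = T-injective (mk⇔ reflect preserve)
    where
    Meet-γ : Meet (ends H (γ H ψ a)) (ends H (γ H ψ b)) ⇔ Meet (ends H a) (ends H b)
    Meet-γ = mk⇔
      (to (Meet-map (injective ψ-emb)) ∘ Meet-resp-≈ₚ (γ-ends a) (γ-ends b))
      (Meet-resp-≈ₚ (≈ₚ-sym (γ-ends a)) (≈ₚ-sym (γ-ends b)) ∘ from (Meet-map (injective ψ-emb)))
    reflect : T (adj (L H) (γ H ψ a) (γ H ψ b)) → T (adj (L H) a b)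
    reflect t with to (T-adj-L H _ _) t
    ... | γa≢γb , m = from (T-adj-L H a b) (γa≢γb ∘ cong (γ H ψ) , to Meet-γ m)
    preserve : T (adj (L H) a b) → T (adj (L H) (γ H ψ a) (γ H ψ b))
    preserve t with to (T-adj-L H a b) t
    ... | a≢b , m = from (T-adj-L H _ _) (a≢b ∘ γ-injective , from Meet-γ m)

  IsInducedEmbedding-γ : IsInducedEmbedding (L H) (γ H ψ)
  IsInducedEmbedding-γ = record { injective = γ-injective ; adj-preserved = γ-adj-preserved }

f-natural : (H : Graph) → Symmetric H → (ψ : V H → V H) → IsInducedEmbedding H ψ →
  ∀ x → f H (γ (L H) (γ H ψ) x) ≡ ψ (f H x)
f-natural H H-sym ψ ψ-emb x =
  common-unique (¬≈ₚ-ends H c≢d) (ψw∈ (∈ₚ-resp-≈ₚ cd≈ (inj₁ refl))) (ψw∈ (∈ₚ-resp-≈ₚ cd≈ (inj₂ refl)))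
  where
  a = proj₁ (ends (L H) x)
  b = proj₂ (ends (L H) x)
  w∈ = common-∈ₚ (proj₂ (to (T-adj-L H a b) (ends-adj (L H) x)))
  c = proj₁ (ends (L H) (γ (L H) (γ H ψ) x))
  d = proj₂ (ends (L H) (γ (L H) (γ H ψ) x))
  cd≈ : (c , d) ≈ₚ (γ H ψ a , γ H ψ b)
  cd≈ = γ-ends (L H) (Symmetric-L H) (γ H ψ) (IsInducedEmbedding-γ H H-sym ψ ψ-emb) x
  c≢d : c ≢ d
  c≢d = proj₁ (to (T-adj-L H c d) (ends-adj (L H) _))
  ψw∈ : ∀ {z} → z ∈ₚ (γ H ψ a , γ H ψ b) → ψ (f H x) ∈ₚ ends H z
  ψw∈ (inj₁ refl) = ∈ₚ-resp-≈ₚ (≈ₚ-sym (γ-ends H H-sym ψ ψ-emb a)) (∈ₚ-map ψ (proj₁ w∈))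
  ψw∈ (inj₂ refl) = ∈ₚ-resp-≈ₚ (≈ₚ-sym (γ-ends H H-sym ψ ψ-emb b)) (∈ₚ-map ψ (proj₂ w∈))

IsInducedEmbedding-γₖ : (G : Graph) → Symmetric G → (ψ : V G → V G) → IsInducedEmbedding G ψ →
  ∀ k → IsInducedEmbedding (Lⁿ k G) (γₖ G k ψ)
IsInducedEmbedding-γₖ G G-sym ψ ψ-emb zero = ψ-emb
IsInducedEmbedding-γₖ G G-sym ψ ψ-emb (suc k) =
  IsInducedEmbedding-γ (Lⁿ k G) (Symmetric-Lⁿ G G-sym k) (γₖ G k ψ)
    (IsInducedEmbedding-γₖ G G-sym ψ ψ-emb k)

⟨⟩-γₖ : (G : Graph) → Symmetric G → (ψ : V G → V G) → IsInducedEmbedding G ψ →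
  ∀ m v x → ⟨ ψ v ⟩ m (γₖ G (twice m) ψ x) ⇔ ⟨ v ⟩ m x
⟨⟩-γₖ G G-sym ψ ψ-emb zero v x = mk⇔ (injective ψ-emb) (cong ψ)
⟨⟩-γₖ G G-sym ψ ψ-emb (suc m) v x =
  subst (λ y → ⟨ ψ v ⟩ m y ⇔ ⟨ v ⟩ (suc m) x)
    (sym (f-natural (Lⁿ (twice m) G) (Symmetric-Lⁿ G G-sym (twice m)) (γₖ G (twice m) ψ)
      (IsInducedEmbedding-γₖ G G-sym ψ ψ-emb (twice m)) x))
    (⟨⟩-γₖ G G-sym ψ ψ-emb m v (f (Lⁿ (twice m) G) x))

IsAut⇒IsInducedEmbedding : (G : Graph) (ψ : V G → V G) → IsAut G ψ → IsInducedEmbedding G ψ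
IsAut⇒IsInducedEmbedding G ψ ((ψ⁻¹ , ψ⁻¹∘ψ , _) , ψ-adj) = record
  { injective = λ {i} {j} ψi≡ψj → trans (sym (ψ⁻¹∘ψ i)) (trans (cong ψ⁻¹ ψi≡ψj) (ψ⁻¹∘ψ j))
  ; adj-preserved = ψ-adj
  }

corollary3 : (G : Graph) → IsSimple G → Connected G
    → ¬ (G ≅ P₂) → ¬ (G ≅ Q) → ¬ (G ≅ L Q)
    → (m : ℕ) → 0 < m
    → (φ : V (Lⁿ (twice m) G) → V (Lⁿ (twice m) G)) → IsAut (Lⁿ (twice m) G) φ
    → (φ′ : V G → V G) → IsAut G φ′
    → (∀ x → γₖ G (twice m) φ′ x ≡ φ x)
    → (v : V G) → (y : V (Lⁿ (twice m) G))
    → (⟨ φ′ v ⟩ m y ⇔ Σ (V (Lⁿ (twice m) G)) (λ x → ⟨ v ⟩ m x × φ x ≡ y))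
corollary3 G (G-sym , _) _ _ _ _ m _ φ ((φ⁻¹ , _ , φ∘φ⁻¹) , _) φ′ φ′-aut γφ′≡φ v y =
  mk⇔ (λ h → φ⁻¹ y , to (φ′-⟨⟩ (φ⁻¹ y)) (subst (⟨ φ′ v ⟩ m) (sym (image (φ∘φ⁻¹ y))) h) , φ∘φ⁻¹ y)
      (λ (x , hx , φx≡y) → subst (⟨ φ′ v ⟩ m) (image φx≡y) (from (φ′-⟨⟩ x) hx))
  where
  φ′-⟨⟩ : ∀ x → ⟨ φ′ v ⟩ m (γₖ G (twice m) φ′ x) ⇔ ⟨ v ⟩ m x
  φ′-⟨⟩ = ⟨⟩-γₖ G G-sym φ′ (IsAut⇒IsInducedEmbedding G φ′ φ′-aut) m v
  image : ∀ {x} → φ x ≡ y → γₖ G (twice m) φ′ x ≡ y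
  image {x} φx≡y = trans (γφ′≡φ x) φx≡y
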